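{- For nonnegative integers $n,m$ there exists a bijection $\mathrm{SW}:\mathbf C_n\times\mathbf C_m\to\mathbf C_m\times\mathbf C_n$ such that for every $L\in\mathbf C_n\times\mathbf C_m$, $y^L=y^{\mathrm{SW}(L)}$ and $\operatorname{dinv}(L)=\operatorname{dinv}(\mathrm{SW}(L))$.
   Context: Let $\mathbf P$ be the poset on $\mathbb{Z}_{\ge0}\times\mathbb{Z}_{\ge1}$ with $(a,b)\prec_{\mathbf P}(c,d)$ iff $a+1<c$, or $a+1=c$ and $b\ge d$. $\mathbf C_m$ is the set of $\mathbf P$-chains $\{(a_1,b_1)\prec_{\mathbf P}\cdots\prec_{\mathbf P}(a_m,b_m)\}$ of $m$ elements of $\mathbb{Z}_{\ge0}\times\mathbb{Z}_{\ge1}$. For a tuple $L=(L_1,\dots,L_r)$ of finite multisets of $\mathbb{Z}_{\ge0}\times\mathbb{Z}_{\ge1}$, $\operatorname{dinv}(L)=\sum_{i<j}\sum_{(a,b)\in L_i,(a',b')\in L_j}\big(\chi(a=a')\chi(b>b')+\chi(a+1=a')\chi(b<b')\big)$, and $y^L=\prod_i\prod_{(a,b)\in L_i}y_{a,b}$ in indeterminates $y_{a,b}$. -}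

module Defs where

open import Data.Nat using (ℕ; zero; suc; _+_; _≡ᵇ_; _<ᵇ_; _≤ᵇ_)
open import Data.Bool using (Bool; true; false; _∧_; _∨_; T; if_then_else_)
open import Data.Product using (Σ; _×_; _,_; proj₁; proj₂)
open import Data.Vec using (Vec; []; _∷_; toList)
open import Data.List as List using (List; []; _∷_; _++_; map; concatMap)
open import Data.Nat.ListAction using (sum)

Pt : Set
Pt = Σ (ℕ × ℕ) (λ ab → T (1 ≤ᵇ proj₂ ab))

fst snd : Pt → ℕ
fst p = proj₁ (proj₁ p)
snd p = proj₂ (proj₁ p)

precᵇ : Pt → Pt → Bool
precᵇ p q = (suc (fst p) <ᵇ fst q) ∨ ((suc (fst p) ≡ᵇ fst q) ∧ (snd q ≤ᵇ snd p))

_≺_ : Pt → Pt → Set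
p ≺ q = T (precᵇ p q)

allᵇ : (Pt → Bool) → List Pt → Bool
allᵇ f [] = true
allᵇ f (x ∷ xs) = f x ∧ allᵇ f xs

chainᵇ : List Pt → Bool
chainᵇ [] = true
chainᵇ (x ∷ xs) = allᵇ (precᵇ x) xs ∧ chainᵇ xs

-- C_m : P-chains with m elements, written in increasing order p₁ ≺ ⋯ ≺ pₘ.
C : ℕ → Set
C m = Σ (Vec Pt m) (λ v → T (chainᵇ (toList v)))

elems : ∀ {m} → C m → List Pt
elems c = toList (proj₁ c)

χ : Bool → ℕ
χ true = 1
χ false = 0

-- contribution of (a,b) ∈ L_i, (a',b') ∈ L_j with i < j
dinvPair : Pt → Pt → ℕ
dinvPair p q =
  χ (fst p ≡ᵇ fst q) * χ (snd q <ᵇ snd p) + χ (suc (fst p) ≡ᵇ fst q) * χ (snd p <ᵇ snd q)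
  where open import Data.Nat using (_*_)

dinv₂ : List Pt → List Pt → ℕ
dinv₂ L₁ L₂ = sum (concatMap (λ p → map (dinvPair p) L₂) L₁)

-- the monomial y^L of L = (L₁ , L₂), represented by the multiset (list up to permutation)
-- of all points of L₁ and L₂
ymon : List Pt → List Pt → List Pt
ymon L₁ L₂ = L₁ ++ L₂

dinvC : ∀ {n m} → C n × C m → ℕ
dinvC (c , d) = dinv₂ (elems c) (elems d)

yC : ∀ {n m} → C n × C m → List Pt
yC (c , d) = ymon (elems c) (elems d)

module Submission where

-- Merge the two chains into columns, one per first coordinate; a column holds at most one point
-- of each chain, since the first coordinates along a chain increase.  Then dinv is a sum of
-- contributions inside columns and between adjacent columns, and both rows stay chains after
-- exchanging the two points of some columns as long as no two adjacent columns with
-- interleaving values ("joined" columns) are treated differently.  SW therefore cuts the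
-- columns into maximal runs of joined columns and exchanges the rows of every run with
-- different numbers of upper and lower points.  Edges between runs contribute nothing in either
-- orientation, and inside a run the contributions alternate in such a way that exchanging the
-- rows changes dinv by at most one, and only when the run has as many upper as lower points.
-- Since runs are preserved by the exchange, SW is an involution.

open import Defs
open import Algebra.Bundles using (CommutativeMonoid)
open import Data.Bool using (Bool; true; false; T; not)
open import Data.Bool.Properties using (T-∧; T-∨; T-irrelevant; not-injective)
open import Data.Empty using (⊥; ⊥-elim)
open import Data.List using (List; []; _∷_; _++_; map; concat; length)
open import Data.List.Membership.Propositional using (_∈_)
open import Data.List.Properties using (length-++; map-++; ++-assoc; map-id; map-cong; map-∘)
open import Data.List.Relation.Binary.Permutation.Propositional
  using (_↭_; ↭-refl; ↭-reflexive; ↭-sym; ↭-trans; module PermutationReasoning)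
open import Data.List.Relation.Binary.Permutation.Propositional.Properties
  using (++-comm; ++-commutativeMonoid) renaming (++⁺ to ++⁺-↭)
open import Data.List.Relation.Unary.All as All using (All; []; _∷_)
open import Data.List.Relation.Unary.All.Properties using (++⁺)
open import Data.List.Relation.Unary.AllPairs using (AllPairs; []; _∷_)
import Data.List.Relation.Unary.AllPairs.Properties as AllPairs
open import Data.List.Relation.Unary.Linked as Linked using (Linked; []; [-]; _∷_)
open import Data.Nat using (ℕ; zero; suc; _+_; _≤_; _<_; _⊓_; _⊔_; _≡ᵇ_; _<ᵇ_; _≟_; _<?_)
open import Data.Nat.ListAction using (sum)
open import Data.Nat.ListAction.Properties using (sum-++)
open import Data.Nat.Properties
open import Data.Product using (Σ; _×_; _,_; proj₁; proj₂)
open import Data.Sum using (_⊎_; inj₁; inj₂)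
open import Data.Unit using (⊤; tt)
open import Data.Vec using (toList; fromList; cast)
open import Data.Vec.Properties using (toList-injective; toList-cast; toList∘fromList; length-toList)
open import Data.Vec.Relation.Binary.Equality.Cast using (cast-is-id)
open import Function.Base using (_∘_)
open import Function.Bundles using (_⤖_; Bijection; Equivalence; mk↔ₛ′)
open import Function.Properties.Inverse using (↔⇒⤖)
open import Relation.Binary using (tri<; tri≈; tri>)
open import Relation.Binary.PropositionalEquality
open import Relation.Nullary using (¬_; Dec; yes; no)
open import Relation.Nullary.Decidable using (_×-dec_)

open import Algebra.Properties.CommutativeSemigroup +-commutativeSemigroup using (interchange)
open import Algebra.Properties.CommutativeSemigroup (CommutativeMonoid.commutativeSemigroup (++-commutativeMonoid {A = Pt}))
  using () renaming (interchange to ++-interchange)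

≡ᵇ-comm : ∀ m n → (m ≡ᵇ n) ≡ (n ≡ᵇ m)
≡ᵇ-comm zero zero = refl
≡ᵇ-comm zero (suc n) = refl
≡ᵇ-comm (suc m) zero = refl
≡ᵇ-comm (suc m) (suc n) = ≡ᵇ-comm m n

<-⊔-cancelˡ : ∀ {a b c} → a < b ⊔ c → b ≤ a → a < c
<-⊔-cancelˡ a<b⊔c b≤a = ≰⇒> (λ c≤a → <⇒≱ a<b⊔c (⊔-lub b≤a c≤a))

<-⊔-cancelʳ : ∀ {a b c} → a < b ⊔ c → c ≤ a → a < b
<-⊔-cancelʳ a<b⊔c c≤a = ≰⇒> (λ b≤a → <⇒≱ a<b⊔c (⊔-lub b≤a c≤a))

module _ {A : Set} {R : A → A → Set} where

  Linked-++⁻ˡ : ∀ xs {ys} → Linked R (xs ++ ys) → Linked R xs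
  Linked-++⁻ˡ [] _ = []
  Linked-++⁻ˡ (x ∷ []) _ = [-]
  Linked-++⁻ˡ (x ∷ y ∷ xs) (r ∷ l) = r ∷ Linked-++⁻ˡ (y ∷ xs) l

  Linked-++⁻ʳ : ∀ xs {ys} → Linked R (xs ++ ys) → Linked R ys
  Linked-++⁻ʳ [] l = l
  Linked-++⁻ʳ (x ∷ xs) l = Linked-++⁻ʳ xs (Linked.tail l)

χ-true : ∀ {b} → T b → χ b ≡ 1
χ-true {true} _ = refl

χ-false : ∀ {b} → ¬ T b → χ b ≡ 0
χ-false {true} ¬t = ⊥-elim (¬t tt)
χ-false {false} _ = refl

χ-< : ∀ {m n} → m < n → χ (m <ᵇ n) ≡ 1
χ-< lt = χ-true (<⇒<ᵇ lt)

χ-≥ : ∀ {m n} → n ≤ m → χ (m <ᵇ n) ≡ 0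
χ-≥ le = χ-false (λ t → <⇒≱ (<ᵇ⇒< _ _ t) le)

≺-far : ∀ p q → suc (fst p) < fst q → p ≺ q
≺-far p q lt = Equivalence.from T-∨ (inj₁ (<⇒<ᵇ lt))

≺-adjacent : ∀ p q → suc (fst p) ≡ fst q → snd q ≤ snd p → p ≺ q
≺-adjacent p q e le = Equivalence.from T-∨ (inj₂ (Equivalence.from T-∧ (≡⇒≡ᵇ _ _ e , ≤⇒≤ᵇ le)))

≺⇒fst< : ∀ p q → p ≺ q → fst p < fst q
≺⇒fst< p q p≺q with Equivalence.to T-∨ p≺q
... | inj₁ far = <-trans (n<1+n _) (<ᵇ⇒< _ _ far)
... | inj₂ adj = ≤-reflexive (≡ᵇ⇒≡ _ _ (proj₁ (Equivalence.to T-∧ adj)))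

≺-adjacent⇒snd≥ : ∀ p q → p ≺ q → suc (fst p) ≡ fst q → snd q ≤ snd p
≺-adjacent⇒snd≥ p q p≺q e with Equivalence.to T-∨ p≺q
... | inj₁ far = ⊥-elim (<-irrefl e (<ᵇ⇒< _ _ far))
... | inj₂ adj = ≤ᵇ⇒≤ _ _ (proj₂ (Equivalence.to T-∧ adj))

allᵇ⇒All : ∀ p xs → T (allᵇ (precᵇ p) xs) → All (p ≺_) xs
allᵇ⇒All p [] _ = []
allᵇ⇒All p (x ∷ xs) t = let (hd , tl) = Equivalence.to T-∧ t in hd ∷ allᵇ⇒All p xs tl

All⇒allᵇ : ∀ p xs → All (p ≺_) xs → T (allᵇ (precᵇ p) xs)
All⇒allᵇ p [] [] = tt
All⇒allᵇ p (x ∷ xs) (hd ∷ tl) =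
  Equivalence.from (T-∧ {precᵇ p x} {allᵇ (precᵇ p) xs}) (hd , All⇒allᵇ p xs tl)

chainᵇ⇒AllPairs : ∀ xs → T (chainᵇ xs) → AllPairs _≺_ xs
chainᵇ⇒AllPairs [] _ = []
chainᵇ⇒AllPairs (x ∷ xs) t =
  let (hd , tl) = Equivalence.to T-∧ t in allᵇ⇒All x xs hd ∷ chainᵇ⇒AllPairs xs tl

AllPairs⇒chainᵇ : ∀ xs → AllPairs _≺_ xs → T (chainᵇ xs)
AllPairs⇒chainᵇ [] [] = tt
AllPairs⇒chainᵇ (x ∷ xs) (hd ∷ tl) =
  Equivalence.from (T-∧ {allᵇ (precᵇ x) xs} {chainᵇ xs}) (All⇒allᵇ x xs hd , AllPairs⇒chainᵇ xs tl)

dinvPair-column : ∀ p q → fst p ≡ fst q → dinvPair p q ≡ χ (snd q <ᵇ snd p)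
dinvPair-column p q e
  rewrite χ-true (≡⇒≡ᵇ _ _ e)
        | χ-false {suc (fst p) ≡ᵇ fst q} (λ t → <-irrefl (trans e (sym (≡ᵇ⇒≡ _ _ t))) (n<1+n _))
  = trans (+-identityʳ _) (+-identityʳ _)

dinvPair-adjacent : ∀ p q → suc (fst p) ≡ fst q → dinvPair p q ≡ χ (snd p <ᵇ snd q)
dinvPair-adjacent p q e
  rewrite χ-false {fst p ≡ᵇ fst q} (λ t → <-irrefl (trans (≡ᵇ⇒≡ _ _ t) (sym e)) (n<1+n _))
        | χ-true (≡⇒≡ᵇ _ _ e)
  = +-identityʳ _

dinvPair-distant : ∀ p q → fst p ≢ fst q → suc (fst p) ≢ fst q → dinvPair p q ≡ 0
dinvPair-distant p q ≢ ≢suc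
  rewrite χ-false {fst p ≡ᵇ fst q} (≢ ∘ ≡ᵇ⇒≡ _ _)
        | χ-false {suc (fst p) ≡ᵇ fst q} (≢suc ∘ ≡ᵇ⇒≡ _ _)
  = refl

dinvPair-far : ∀ p q → suc (fst p) < fst q → dinvPair p q ≡ 0
dinvPair-far p q lt = dinvPair-distant p q (λ e → <-asym (n<1+n _) (subst (λ i → suc i < fst q) e lt)) (<⇒≢ lt)

dinvPair-leftward : ∀ p q → fst q < fst p → dinvPair p q ≡ 0
dinvPair-leftward p q lt = dinvPair-distant p q (>⇒≢ lt) (>⇒≢ (<-trans lt (n<1+n _)))

dinv₂-∷ˡ : ∀ p A V → dinv₂ (p ∷ A) V ≡ sum (map (dinvPair p) V) + dinv₂ A V
dinv₂-∷ˡ p A V = sum-++ (map (dinvPair p) V) _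

dinv₂-++ˡ : ∀ A A′ V → dinv₂ (A ++ A′) V ≡ dinv₂ A V + dinv₂ A′ V
dinv₂-++ˡ [] A′ V = refl
dinv₂-++ˡ (p ∷ A) A′ V = begin
  dinv₂ (p ∷ A ++ A′) V                              ≡⟨ dinv₂-∷ˡ p (A ++ A′) V ⟩
  sum (map (dinvPair p) V) + dinv₂ (A ++ A′) V       ≡⟨ cong (sum (map (dinvPair p) V) +_) (dinv₂-++ˡ A A′ V) ⟩
  sum (map (dinvPair p) V) + (dinv₂ A V + dinv₂ A′ V) ≡⟨ +-assoc (sum (map (dinvPair p) V)) _ _ ⟨
  sum (map (dinvPair p) V) + dinv₂ A V + dinv₂ A′ V  ≡⟨ cong (_+ dinv₂ A′ V) (dinv₂-∷ˡ p A V) ⟨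
  dinv₂ (p ∷ A) V + dinv₂ A′ V                       ∎
  where open ≡-Reasoning

dinv₂-++ʳ : ∀ A V V′ → dinv₂ A (V ++ V′) ≡ dinv₂ A V + dinv₂ A V′
dinv₂-++ʳ [] V V′ = refl
dinv₂-++ʳ (p ∷ A) V V′ = begin
  dinv₂ (p ∷ A) (V ++ V′)                                          ≡⟨ dinv₂-∷ˡ p A (V ++ V′) ⟩
  sum (map (dinvPair p) (V ++ V′)) + dinv₂ A (V ++ V′)             ≡⟨ cong₂ _+_ row-++ (dinv₂-++ʳ A V V′) ⟩
  (row V + row V′) + (dinv₂ A V + dinv₂ A V′)                      ≡⟨ interchange (row V) (row V′) _ _ ⟩
  (row V + dinv₂ A V) + (row V′ + dinv₂ A V′)                      ≡⟨ cong₂ _+_ (dinv₂-∷ˡ p A V) (dinv₂-∷ˡ p A V′) ⟨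
  dinv₂ (p ∷ A) V + dinv₂ (p ∷ A) V′                               ∎
  where
  open ≡-Reasoning
  row : List Pt → ℕ
  row W = sum (map (dinvPair p) W)
  row-++ : row (V ++ V′) ≡ row V + row V′
  row-++ = trans (cong sum (map-++ (dinvPair p) V V′)) (sum-++ (map (dinvPair p) V) _)

dinv₂-vanishes : ∀ A V → All (λ p → All (λ q → dinvPair p q ≡ 0) V) A → dinv₂ A V ≡ 0
dinv₂-vanishes [] V [] = refl
dinv₂-vanishes (p ∷ A) V (p0 ∷ A0) =
  trans (dinv₂-∷ˡ p A V) (cong₂ _+_ (row-vanishes V p0) (dinv₂-vanishes A V A0))
  where
  row-vanishes : ∀ V → All (λ q → dinvPair p q ≡ 0) V → sum (map (dinvPair p) V) ≡ 0
  row-vanishes [] [] = refl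
  row-vanishes (q ∷ V) (q0 ∷ V0) = cong₂ _+_ q0 (row-vanishes V V0)

dinv₂-column : ∀ p q → fst p ≡ fst q → dinv₂ (p ∷ []) (q ∷ []) ≡ χ (snd q <ᵇ snd p)
dinv₂-column p q e = trans (+-identityʳ _) (dinvPair-column p q e)

dinv₂-adjacent : ∀ p q → suc (fst p) ≡ fst q → dinv₂ (p ∷ []) (q ∷ []) ≡ χ (snd p <ᵇ snd q)
dinv₂-adjacent p q e = trans (+-identityʳ _) (dinvPair-adjacent p q e)

-- Columns

data Side : Set where
  upper lower : Side

opposite : Side → Side
opposite upper = lower
opposite lower = upper

-- Upper points come from the first chain, lower points from the second.
data Column : Set where
  only : Side → Pt → Column
  both : (p q : Pt) → fst p ≡ fst q → Column

points : Side → Column → List Pt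
points upper (only upper p) = p ∷ []
points upper (only lower p) = []
points lower (only upper p) = []
points lower (only lower p) = p ∷ []
points upper (both p q _) = p ∷ []
points lower (both p q _) = q ∷ []

index : Column → ℕ
index (only _ p) = fst p
index (both p _ _) = fst p

points-index : ∀ s c → All (λ p → fst p ≡ index c) (points s c)
points-index upper (only upper p) = refl ∷ []
points-index upper (only lower p) = []
points-index lower (only upper p) = []
points-index lower (only lower p) = refl ∷ []
points-index upper (both p q e) = refl ∷ []
points-index lower (both p q e) = sym e ∷ []

points-AllPairs : ∀ {R : Pt → Pt → Set} s c → AllPairs R (points s c)
points-AllPairs upper (only upper p) = [] ∷ []
points-AllPairs upper (only lower p) = []
points-AllPairs lower (only upper p) = []
points-AllPairs lower (only lower p) = [] ∷ []
points-AllPairs upper (both p q e) = [] ∷ []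
points-AllPairs lower (both p q e) = [] ∷ []

swapColumn : Column → Column
swapColumn (only s p) = only (opposite s) p
swapColumn (both p q e) = both q p (sym e)

swapColumn-involutive : ∀ c → swapColumn (swapColumn c) ≡ c
swapColumn-involutive (only upper p) = refl
swapColumn-involutive (only lower p) = refl
swapColumn-involutive (both p q e) = cong (both p q) (≡-irrelevant _ _)

points-swap : ∀ s c → points s (swapColumn c) ≡ points (opposite s) c
points-swap upper (only upper p) = refl
points-swap upper (only lower p) = refl
points-swap lower (only upper p) = refl
points-swap lower (only lower p) = refl
points-swap upper (both p q e) = refl
points-swap lower (both p q e) = refl

index-swap : ∀ c → index (swapColumn c) ≡ index c
index-swap (only s p) = refl
index-swap (both p q e) = sym e

gather : Side → List Column → List Pt
gather s [] = []
gather s (c ∷ cs) = points s c ++ gather s cs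

gather-++ : ∀ s cs ds → gather s (cs ++ ds) ≡ gather s cs ++ gather s ds
gather-++ s [] ds = refl
gather-++ s (c ∷ cs) ds = trans (cong (points s c ++_) (gather-++ s cs ds)) (sym (++-assoc (points s c) _ _))

gather-swap : ∀ s cs → gather s (map swapColumn cs) ≡ gather (opposite s) cs
gather-swap s [] = refl
gather-swap s (c ∷ cs) = cong₂ _++_ (points-swap s c) (gather-swap s cs)

-- The recursion on the second list is nested inside the first so that it is structural.
mergeCons : Pt → (List Pt → List Column) → List Pt → List Column
mergeCons x merge-xs [] = only upper x ∷ merge-xs []
mergeCons x merge-xs (y ∷ ys) with <-cmp (fst x) (fst y)
... | tri< _ _ _ = only upper x ∷ merge-xs (y ∷ ys)
... | tri≈ _ e _ = both x y e ∷ merge-xs ys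
... | tri> _ _ _ = only lower y ∷ mergeCons x merge-xs ys

merge : List Pt → List Pt → List Column
merge [] [] = []
merge [] (y ∷ ys) = only lower y ∷ merge [] ys
merge (x ∷ xs) ys = mergeCons x (merge xs) ys

gather-merge-upper : ∀ xs ys → gather upper (merge xs ys) ≡ xs
gather-merge-upper [] [] = refl
gather-merge-upper [] (y ∷ ys) = gather-merge-upper [] ys
gather-merge-upper (x ∷ xs) = go
  where
  go : ∀ ys → gather upper (merge (x ∷ xs) ys) ≡ x ∷ xs
  go [] = cong (x ∷_) (gather-merge-upper xs [])
  go (y ∷ ys) with <-cmp (fst x) (fst y)
  ... | tri< _ _ _ = cong (x ∷_) (gather-merge-upper xs (y ∷ ys))
  ... | tri≈ _ _ _ = cong (x ∷_) (gather-merge-upper xs ys)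
  ... | tri> _ _ _ = go ys

gather-merge-lower : ∀ xs ys → gather lower (merge xs ys) ≡ ys
gather-merge-lower [] [] = refl
gather-merge-lower [] (y ∷ ys) = cong (y ∷_) (gather-merge-lower [] ys)
gather-merge-lower (x ∷ xs) = go
  where
  go : ∀ ys → gather lower (merge (x ∷ xs) ys) ≡ ys
  go [] = gather-merge-lower xs []
  go (y ∷ ys) with <-cmp (fst x) (fst y)
  ... | tri< _ _ _ = gather-merge-lower xs (y ∷ ys)
  ... | tri≈ _ _ _ = cong (y ∷_) (gather-merge-lower xs ys)
  ... | tri> _ _ _ = cong (y ∷_) (go ys)

Dominates : List Pt → List Pt → Set
Dominates ps qs = All (λ p → All (λ q → snd q ≤ snd p) qs) ps

Adjacent : Column → Column → Set
Adjacent c d = suc (index c) ≡ index d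

-- Points of non-adjacent columns are always ≺-related, so the chain conditions are local.
Step : Column → Column → Set
Step c d = index c < index d × (Adjacent c d → ∀ s → Dominates (points s c) (points s d))

Valid : List Column → Set
Valid = Linked Step

step-swap : ∀ c d → Step c d → Step (swapColumn c) (swapColumn d)
step-swap c d (lt , dominates) =
  subst₂ _<_ (sym (index-swap c)) (sym (index-swap d)) lt ,
  λ adj s → subst₂ Dominates (sym (points-swap s c)) (sym (points-swap s d))
              (dominates (subst₂ (λ i j → suc i ≡ j) (index-swap c) (index-swap d) adj) (opposite s))

later-points : ∀ s c cs → Valid (c ∷ cs) → All (λ q → index c < fst q) (gather s cs)
later-points s c [] _ = []
later-points s c (d ∷ cs) ((lt , _) ∷ v) =
  ++⁺ (All.map (λ e → subst (index c <_) (sym e) lt) (points-index s d))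
      (All.map (<-trans lt) (later-points s d cs v))

precedes-later : ∀ s c cs → Valid (c ∷ cs) → All (λ p → All (p ≺_) (gather s cs)) (points s c)
precedes-later s c [] _ = All.tabulate (λ _ → [])
precedes-later s c (d ∷ cs) ((lt , dominates) ∷ v) = All.tabulate λ {p} p∈c →
  let p-index = All.lookup (points-index s c) p∈c in
  ++⁺ (All.tabulate (≺-next p∈c p-index))
      (All.map (λ {q} d<q → ≺-far p q (subst (λ i → suc i < fst q) (sym p-index) (≤-<-trans lt d<q)))
               (later-points s d cs v))
  where
  ≺-next : ∀ {p q} → p ∈ points s c → fst p ≡ index c → q ∈ points s d → p ≺ q
  ≺-next {p} {q} p∈c p-index q∈d = by-distance (m≤n⇒m<n∨m≡n lt)
    where
    q-index = All.lookup (points-index s d) q∈d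
    by-distance : suc (index c) < index d ⊎ Adjacent c d → p ≺ q
    by-distance (inj₁ far) = ≺-far p q (subst₂ (λ i j → suc i < j) (sym p-index) (sym q-index) far)
    by-distance (inj₂ adj) = ≺-adjacent p q (trans (cong suc p-index) (trans adj (sym q-index)))
                               (All.lookup (All.lookup (dominates adj s) p∈c) q∈d)

gather-chain : ∀ s cs → Valid cs → AllPairs _≺_ (gather s cs)
gather-chain s [] _ = []
gather-chain s (c ∷ cs) v =
  AllPairs.++⁺ (points-AllPairs s c) (gather-chain s cs (Linked.tail v)) (precedes-later s c cs v)

Above : Column → Side → Pt → Set
Above c s q = index c < fst q × All (_≺ q) (points s c)

step-from-Above : ∀ c d → (∀ s → All (Above c s) (points s d)) → Step c d
step-from-Above c d above = index< d (above upper) (above lower) , dominates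
  where
  index< : ∀ d → All (Above c upper) (points upper d) → All (Above c lower) (points lower d) → index c < index d
  index< (only upper p) ((lt , _) ∷ []) _ = lt
  index< (only lower p) _ ((lt , _) ∷ []) = lt
  index< (both p q e) ((lt , _) ∷ []) _ = lt
  dominates : Adjacent c d → ∀ s → Dominates (points s c) (points s d)
  dominates adj s = All.tabulate λ {p} p∈c → All.tabulate λ {q} q∈d →
    ≺-adjacent⇒snd≥ p q (All.lookup (proj₂ (All.lookup (above s) q∈d)) p∈c)
      (trans (cong suc (All.lookup (points-index s c) p∈c)) (trans adj (sym (All.lookup (points-index s d) q∈d))))

Valid-∷ : ∀ c cs → All (λ d → ∀ s → All (Above c s) (points s d)) cs → Valid cs → Valid (c ∷ cs)
Valid-∷ c [] _ _ = [-]
Valid-∷ c (d ∷ cs) (above ∷ _) v = step-from-Above c d above ∷ v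

dominated : ∀ {p q} → Dominates (p ∷ []) (q ∷ []) → snd q ≤ snd p
dominated ((q≤p ∷ []) ∷ []) = q≤p

module _ {P : Side → Pt → Set} where

  only-All : ∀ s p → P s p → ∀ s′ → All (P s′) (points s′ (only s p))
  only-All upper p h upper = h ∷ []
  only-All upper p h lower = []
  only-All lower p h upper = []
  only-All lower p h lower = h ∷ []

  both-All : ∀ p q e → P upper p → P lower q → ∀ s → All (P s) (points s (both p q e))
  both-All p q e hp hq upper = hp ∷ []
  both-All p q e hp hq lower = hq ∷ []

  merge-All : ∀ xs ys → All (P upper) xs → All (P lower) ys →
              All (λ d → ∀ s → All (P s) (points s d)) (merge xs ys)
  merge-All [] [] _ _ = []
  merge-All [] (y ∷ ys) _ (hy ∷ hys) = only-All lower y hy ∷ merge-All [] ys [] hys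
  merge-All (x ∷ xs) ys (hx ∷ hxs) = go ys
    where
    go : ∀ ys → All (P lower) ys → All (λ d → ∀ s → All (P s) (points s d)) (merge (x ∷ xs) ys)
    go [] _ = only-All upper x hx ∷ merge-All xs [] hxs []
    go (y ∷ ys) (hy ∷ hys) with <-cmp (fst x) (fst y)
    ... | tri< _ _ _ = only-All upper x hx ∷ merge-All xs (y ∷ ys) hxs (hy ∷ hys)
    ... | tri≈ _ e _ = both-All x y e hx hy ∷ merge-All xs ys hxs hys
    ... | tri> _ _ _ = only-All lower y hy ∷ go ys hys

Above-of-≺ : ∀ c s x {qs} → points s c ≡ x ∷ [] → fst x ≡ index c → All (x ≺_) qs → All (Above c s) qs
Above-of-≺ c s x single x-index = All.map λ {q} x≺q →
  subst (_< fst q) x-index (≺⇒fst< x q x≺q) , subst (All (_≺ q)) (sym single) (x≺q ∷ [])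

Above-of-< : ∀ c s y {ys} → points s c ≡ [] → index c < fst y → All (y ≺_) ys → All (Above c s) (y ∷ ys)
Above-of-< c s y none c<y y≺ys =
  (c<y , empty y) ∷ All.map (λ {q} y≺q → <-trans c<y (≺⇒fst< y q y≺q) , empty q) y≺ys
  where
  empty : ∀ q → All (_≺ q) (points s c)
  empty q = subst (All (_≺ q)) (sym none) []

merge-valid : ∀ xs ys → AllPairs _≺_ xs → AllPairs _≺_ ys → Valid (merge xs ys)
merge-valid [] [] _ _ = []
merge-valid [] (y ∷ ys) _ (y≺ys ∷ cys) =
  Valid-∷ (only lower y) (merge [] ys) (merge-All [] ys [] (Above-of-≺ (only lower y) lower y refl refl y≺ys))
    (merge-valid [] ys [] cys)
merge-valid (x ∷ xs) ys (x≺xs ∷ cxs) = go ys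
  where
  go : ∀ ys → AllPairs _≺_ ys → Valid (merge (x ∷ xs) ys)
  go [] _ =
    Valid-∷ (only upper x) (merge xs []) (merge-All xs [] (Above-of-≺ (only upper x) upper x refl refl x≺xs) [])
      (merge-valid xs [] cxs [])
  go (y ∷ ys) (y≺ys ∷ cys) with <-cmp (fst x) (fst y)
  ... | tri< x<y _ _ =
    Valid-∷ (only upper x) (merge xs (y ∷ ys))
      (merge-All xs (y ∷ ys) (Above-of-≺ (only upper x) upper x refl refl x≺xs)
                             (Above-of-< (only upper x) lower y refl x<y y≺ys))
      (merge-valid xs (y ∷ ys) cxs (y≺ys ∷ cys))
  ... | tri≈ _ e _ =
    Valid-∷ (both x y e) (merge xs ys)
      (merge-All xs ys (Above-of-≺ (both x y e) upper x refl refl x≺xs)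
                       (Above-of-≺ (both x y e) lower y refl (sym e) y≺ys))
      (merge-valid xs ys cxs cys)
  ... | tri> _ _ y<x =
    Valid-∷ (only lower y) (merge (x ∷ xs) ys)
      (merge-All (x ∷ xs) ys (Above-of-< (only lower y) upper x refl y<x x≺xs)
                             (Above-of-≺ (only lower y) lower y refl refl y≺ys))
      (go ys cys)

merge-upper-first : ∀ p xs ys → All (λ q → fst p < fst q) ys → merge (p ∷ xs) ys ≡ only upper p ∷ merge xs ys
merge-upper-first p xs [] _ = refl
merge-upper-first p xs (y ∷ ys) (p<y ∷ _) with <-cmp (fst p) (fst y)
... | tri< _ _ _ = refl
... | tri≈ _ e _ = ⊥-elim (<-irrefl e p<y)
... | tri> _ _ y<p = ⊥-elim (<-asym p<y y<p)

merge-lower-first : ∀ q xs ys → All (λ p → fst q < fst p) xs → merge xs (q ∷ ys) ≡ only lower q ∷ merge xs ys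
merge-lower-first q [] ys _ = refl
merge-lower-first q (x ∷ xs) ys (q<x ∷ _) with <-cmp (fst x) (fst q)
... | tri< x<q _ _ = ⊥-elim (<-asym q<x x<q)
... | tri≈ _ e _ = ⊥-elim (<-irrefl (sym e) q<x)
... | tri> _ _ _ = refl

merge-both-first : ∀ p q e xs ys → merge (p ∷ xs) (q ∷ ys) ≡ both p q e ∷ merge xs ys
merge-both-first p q e xs ys with <-cmp (fst p) (fst q)
... | tri< p<q _ _ = ⊥-elim (<-irrefl e p<q)
... | tri≈ _ e′ _ = cong (λ e → both p q e ∷ merge xs ys) (≡-irrelevant e′ e)
... | tri> _ _ q<p = ⊥-elim (<-irrefl (sym e) q<p)

merge-gather : ∀ cs → Valid cs → merge (gather upper cs) (gather lower cs) ≡ cs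
merge-gather [] _ = refl
merge-gather (only upper p ∷ cs) v =
  trans (merge-upper-first p (gather upper cs) (gather lower cs) (later-points lower _ cs v))
        (cong (only upper p ∷_) (merge-gather cs (Linked.tail v)))
merge-gather (only lower q ∷ cs) v =
  trans (merge-lower-first q (gather upper cs) (gather lower cs) (later-points upper _ cs v))
        (cong (only lower q ∷_) (merge-gather cs (Linked.tail v)))
merge-gather (both p q e ∷ cs) v =
  trans (merge-both-first p q e (gather upper cs) (gather lower cs))
        (cong (both p q e ∷_) (merge-gather cs (Linked.tail v)))

-- Joined columns and reorientation

low high : Column → ℕ
low (only _ p) = snd p
low (both p q _) = snd p ⊓ snd q
high (only _ p) = snd p
high (both p q _) = snd p ⊔ snd q

-- SW reorients maximal runs of joined columns as a whole.
Joined : Column → Column → Set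
Joined c d = Adjacent c d × low c < high d

joined? : ∀ c d → Dec (Joined c d)
joined? c d = (suc (index c) ≟ index d) ×-dec (low c <? high d)

orient : Bool → Column → Column
orient false c = c
orient true c = swapColumn c

orient-involutive : ∀ o c → orient o (orient o c) ≡ c
orient-involutive false c = refl
orient-involutive true c = swapColumn-involutive c

index-orient : ∀ o c → index (orient o c) ≡ index c
index-orient false c = refl
index-orient true c = index-swap c

low-orient : ∀ o c → low (orient o c) ≡ low c
low-orient false c = refl
low-orient true (only s p) = refl
low-orient true (both p q e) = ⊓-comm (snd q) (snd p)

high-orient : ∀ o c → high (orient o c) ≡ high c
high-orient false c = refl
high-orient true (only s p) = refl
high-orient true (both p q e) = ⊔-comm (snd q) (snd p)

joined-orient : ∀ o o′ {c d} → Joined c d → Joined (orient o c) (orient o′ d)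
joined-orient o o′ {c} {d} (adj , lt) =
  subst₂ (λ i j → suc i ≡ j) (sym (index-orient o c)) (sym (index-orient o′ d)) adj ,
  subst₂ _<_ (sym (low-orient o c)) (sym (high-orient o′ d)) lt

¬joined-orient : ∀ o o′ {c d} → ¬ Joined c d → ¬ Joined (orient o c) (orient o′ d)
¬joined-orient o o′ {c} {d} ¬joined joined =
  ¬joined (subst₂ Joined (orient-involutive o c) (orient-involutive o′ d) (joined-orient o o′ joined))

step-orient : ∀ o {c d} → Step c d → Step (orient o c) (orient o d)
step-orient false step = step
step-orient true {c} {d} step = step-swap c d step

points-low : ∀ s c → All (λ p → low c ≤ snd p) (points s c)
points-low upper (only upper p) = ≤-refl ∷ []
points-low upper (only lower p) = []
points-low lower (only upper p) = []
points-low lower (only lower p) = ≤-refl ∷ []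
points-low upper (both p q e) = m⊓n≤m (snd p) (snd q) ∷ []
points-low lower (both p q e) = m⊓n≤n (snd p) (snd q) ∷ []

points-high : ∀ s c → All (λ p → snd p ≤ high c) (points s c)
points-high upper (only upper p) = ≤-refl ∷ []
points-high upper (only lower p) = []
points-high lower (only upper p) = []
points-high lower (only lower p) = ≤-refl ∷ []
points-high upper (both p q e) = m≤m⊔n (snd p) (snd q) ∷ []
points-high lower (both p q e) = m≤n⊔m (snd p) (snd q) ∷ []

dominates-across : ∀ {ps qs} m → All (λ p → m ≤ snd p) ps → All (λ q → snd q ≤ m) qs → Dominates ps qs
dominates-across m m≤ps qs≤m = All.map (λ m≤p → All.map (λ q≤m → ≤-trans q≤m m≤p) qs≤m) m≤ps

unjoined-high≤low : ∀ c d → ¬ Joined c d → Adjacent c d → high d ≤ low c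
unjoined-high≤low c d ¬joined adj = ≮⇒≥ (λ lt → ¬joined (adj , lt))

step-unjoined : ∀ o o′ {c d} → Step c d → ¬ Joined c d → Step (orient o c) (orient o′ d)
step-unjoined o o′ {c} {d} (lt , _) ¬joined =
  subst₂ _<_ (sym (index-orient o c)) (sym (index-orient o′ d)) lt ,
  λ adj s → dominates-across (low c)
    (subst (λ l → All (λ p → l ≤ snd p) (points s (orient o c))) (low-orient o c) (points-low s (orient o c)))
    (All.map (λ q≤high → ≤-trans q≤high (≤-trans (≤-reflexive (high-orient o′ d))
                                                  (unjoined-high≤low c d ¬joined (adjacent adj))))
             (points-high s (orient o′ d)))
  where
  adjacent : Adjacent (orient o c) (orient o′ d) → Adjacent c d
  adjacent = subst₂ (λ i j → suc i ≡ j) (index-orient o c) (index-orient o′ d)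

-- Blocks

addColumn : Column → List (List Column) → List (List Column)
addColumn c [] = (c ∷ []) ∷ []
addColumn c ([] ∷ bs) = (c ∷ []) ∷ [] ∷ bs    -- never used: blocks are nonempty
addColumn c ((d ∷ b) ∷ bs) with joined? c d
... | yes _ = (c ∷ d ∷ b) ∷ bs
... | no _ = (c ∷ []) ∷ (d ∷ b) ∷ bs

blocks : List Column → List (List Column)
blocks [] = []
blocks (c ∷ cs) = addColumn c (blocks cs)

concat-addColumn : ∀ c bs → concat (addColumn c bs) ≡ c ∷ concat bs
concat-addColumn c [] = refl
concat-addColumn c ([] ∷ bs) = refl
concat-addColumn c ((d ∷ b) ∷ bs) with joined? c d
... | yes _ = refl
... | no _ = refl

concat-blocks : ∀ cs → concat (blocks cs) ≡ cs
concat-blocks [] = refl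
concat-blocks (c ∷ cs) = trans (concat-addColumn c (blocks cs)) (cong (c ∷_) (concat-blocks cs))

NotJoinedTo : Column → List (List Column) → Set
NotJoinedTo c [] = ⊤
NotJoinedTo c ([] ∷ bs) = ⊥
NotJoinedTo c ((d ∷ _) ∷ _) = ¬ Joined c d

RunThen : Column → List Column → List (List Column) → Set
RunThen c [] bs = NotJoinedTo c bs
RunThen c (d ∷ b) bs = Joined c d × RunThen d b bs

Blocking : List (List Column) → Set
Blocking [] = ⊤
Blocking ([] ∷ bs) = ⊥
Blocking ((c ∷ b) ∷ bs) = RunThen c b bs × Blocking bs

addColumn-Blocking : ∀ c bs → Blocking bs → Blocking (addColumn c bs)
addColumn-Blocking c [] _ = tt , tt
addColumn-Blocking c ((d ∷ b) ∷ bs) (run , bl) with joined? c d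
... | yes joined = (joined , run) , bl
... | no ¬joined = ¬joined , run , bl

blocks-Blocking : ∀ cs → Blocking (blocks cs)
blocks-Blocking [] = tt
blocks-Blocking (c ∷ cs) = addColumn-Blocking c (blocks cs) (blocks-Blocking cs)

addColumn-unjoined : ∀ c bs → NotJoinedTo c bs → addColumn c bs ≡ (c ∷ []) ∷ bs
addColumn-unjoined c [] _ = refl
addColumn-unjoined c ((d ∷ b) ∷ bs) ¬joined with joined? c d
... | yes joined = ⊥-elim (¬joined joined)
... | no _ = refl

addColumn-joined : ∀ c d b bs → Joined c d → addColumn c ((d ∷ b) ∷ bs) ≡ (c ∷ d ∷ b) ∷ bs
addColumn-joined c d b bs joined with joined? c d
... | yes _ = refl
... | no ¬joined = ⊥-elim (¬joined joined)

blocks-concat : ∀ bs → Blocking bs → blocks (concat bs) ≡ bs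
blocks-concat [] _ = refl
blocks-concat ((c ∷ b) ∷ bs) (run , bl) = blocks-run c b run
  where
  blocks-run : ∀ c b → RunThen c b bs → blocks (c ∷ b ++ concat bs) ≡ (c ∷ b) ∷ bs
  blocks-run c [] ¬joined =
    trans (cong (addColumn c) (blocks-concat bs bl)) (addColumn-unjoined c bs ¬joined)
  blocks-run c (d ∷ b) (joined , run) =
    trans (cong (addColumn c) (blocks-run d b run)) (addColumn-joined c d b bs joined)

imbalanced : List Column → Bool
imbalanced b = not (length (gather upper b) ≡ᵇ length (gather lower b))

imbalanced⇒length≢ : ∀ b → imbalanced b ≡ true → length (gather upper b) ≢ length (gather lower b)
imbalanced⇒length≢ b imb e = subst T (not-injective imb) (≡⇒≡ᵇ _ _ e)

balanced⇒length≡ : ∀ b → imbalanced b ≡ false → length (gather upper b) ≡ length (gather lower b)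
balanced⇒length≡ b bal = ≡ᵇ⇒≡ _ _ (subst T (sym (not-injective bal)) tt)

imbalanced-orient : ∀ o b → imbalanced (map (orient o) b) ≡ imbalanced b
imbalanced-orient false b = cong imbalanced (map-id b)
imbalanced-orient true b
  rewrite gather-swap upper b | gather-swap lower b = cong not (≡ᵇ-comm (length (gather lower b)) _)

swapBlock : List Column → List Column
swapBlock b = map (orient (imbalanced b)) b

map-orient-involutive : ∀ o b → map (orient o) (map (orient o) b) ≡ b
map-orient-involutive o [] = refl
map-orient-involutive o (c ∷ b) = cong₂ _∷_ (orient-involutive o c) (map-orient-involutive o b)

swapBlock-involutive : ∀ b → swapBlock (swapBlock b) ≡ b
swapBlock-involutive b =
  trans (cong (λ o → map (orient o) (swapBlock b)) (imbalanced-orient (imbalanced b) b))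
        (map-orient-involutive (imbalanced b) b)

swapBlocks : List Column → List Column
swapBlocks cs = concat (map swapBlock (blocks cs))

RunThen-orient : ∀ o c b bs → RunThen c b bs → RunThen (orient o c) (map (orient o) b) (map swapBlock bs)
RunThen-orient o c [] [] _ = tt
RunThen-orient o c [] ((d ∷ b) ∷ bs) ¬joined = ¬joined-orient o (imbalanced (d ∷ b)) ¬joined
RunThen-orient o c (d ∷ b) bs (joined , run) = joined-orient o o joined , RunThen-orient o d b bs run

Blocking-swap : ∀ bs → Blocking bs → Blocking (map swapBlock bs)
Blocking-swap [] _ = tt
Blocking-swap ((c ∷ b) ∷ bs) (run , bl) = RunThen-orient (imbalanced (c ∷ b)) c b bs run , Blocking-swap bs bl

blocks-swapBlocks : ∀ cs → blocks (swapBlocks cs) ≡ map swapBlock (blocks cs)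
blocks-swapBlocks cs = blocks-concat (map swapBlock (blocks cs)) (Blocking-swap (blocks cs) (blocks-Blocking cs))

map-swapBlock-involutive : ∀ bs → map swapBlock (map swapBlock bs) ≡ bs
map-swapBlock-involutive [] = refl
map-swapBlock-involutive (b ∷ bs) = cong₂ _∷_ (swapBlock-involutive b) (map-swapBlock-involutive bs)

swapBlocks-involutive : ∀ cs → swapBlocks (swapBlocks cs) ≡ cs
swapBlocks-involutive cs = begin
  concat (map swapBlock (blocks (swapBlocks cs)))      ≡⟨ cong (concat ∘ map swapBlock) (blocks-swapBlocks cs) ⟩
  concat (map swapBlock (map swapBlock (blocks cs)))   ≡⟨ cong concat (map-swapBlock-involutive (blocks cs)) ⟩
  concat (blocks cs)                                   ≡⟨ concat-blocks cs ⟩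
  cs                                                   ∎
  where open ≡-Reasoning

step-into-swapped : ∀ o c bs → NotJoinedTo c bs → Valid (c ∷ concat bs) →
                    Valid (concat (map swapBlock bs)) → Valid (orient o c ∷ concat (map swapBlock bs))
step-into-swapped o c [] _ _ _ = [-]
step-into-swapped o c ((d ∷ b) ∷ bs) ¬joined v v′ =
  step-unjoined o (imbalanced (d ∷ b)) (Linked.head v) ¬joined ∷ v′

valid-swap-concat : ∀ bs → Blocking bs → Valid (concat bs) → Valid (concat (map swapBlock bs))
valid-swap-concat [] _ _ = []
valid-swap-concat ((c ∷ b) ∷ bs) (run , bl) v = valid-run c b run v
  where
  o = imbalanced (c ∷ b)
  valid-run : ∀ c b → RunThen c b bs → Valid (c ∷ b ++ concat bs) →
              Valid (orient o c ∷ map (orient o) b ++ concat (map swapBlock bs))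
  valid-run c [] ¬joined v = step-into-swapped o c bs ¬joined v (valid-swap-concat bs bl (Linked.tail v))
  valid-run c (d ∷ b) (_ , run) v = step-orient o (Linked.head v) ∷ valid-run d b run (Linked.tail v)

valid-swapBlocks : ∀ cs → Valid cs → Valid (swapBlocks cs)
valid-swapBlocks cs v =
  valid-swap-concat (blocks cs) (blocks-Blocking cs) (subst Valid (sym (concat-blocks cs)) v)

RunThen⇒joined : ∀ c b bs → RunThen c b bs → Linked Joined (c ∷ b)
RunThen⇒joined c [] bs _ = [-]
RunThen⇒joined c (d ∷ b) bs (joined , run) = joined ∷ RunThen⇒joined d b bs run

blocks-valid : ∀ bs → Blocking bs → Valid (concat bs) → All (λ b → Valid b × Linked Joined b) bs
blocks-valid [] _ _ = []
blocks-valid ((c ∷ b) ∷ bs) (run , bl) v =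
  (Linked-++⁻ˡ (c ∷ b) v , RunThen⇒joined c b bs run) ∷ blocks-valid bs bl (Linked-++⁻ʳ (c ∷ b) v)

-- Local dinv

selfDinv : Column → ℕ
selfDinv c = dinv₂ (points upper c) (points lower c)

edgeDinv : Column → Column → ℕ
edgeDinv c d = dinv₂ (points upper c) (points lower d)

edgeToNext : Column → List Column → ℕ
edgeToNext c [] = 0
edgeToNext c (d ∷ _) = edgeDinv c d

localDinv : List Column → ℕ
localDinv [] = 0
localDinv (c ∷ cs) = selfDinv c + edgeToNext c cs + localDinv cs

dinv-later-to-column : ∀ c cs → Valid (c ∷ cs) → dinv₂ (gather upper cs) (points lower c) ≡ 0
dinv-later-to-column c cs v = dinv₂-vanishes _ _
  (All.map (λ {p} c<p → All.map (λ {q} q-index → dinvPair-leftward p q (subst (_< fst p) (sym q-index) c<p))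
                                 (points-index lower c))
           (later-points upper c cs v))

dinv-column-to-later : ∀ c cs → Valid (c ∷ cs) → dinv₂ (points upper c) (gather lower cs) ≡ edgeToNext c cs
dinv-column-to-later c [] v = dinv₂-vanishes (points upper c) [] (All.tabulate (λ _ → []))
dinv-column-to-later c (d ∷ cs) ((c<d , _) ∷ v) = begin
  dinv₂ (points upper c) (points lower d ++ gather lower cs)        ≡⟨ dinv₂-++ʳ (points upper c) (points lower d) _ ⟩
  edgeDinv c d + dinv₂ (points upper c) (gather lower cs)            ≡⟨ cong (edgeDinv c d +_) beyond-next ⟩
  edgeDinv c d + 0                                                   ≡⟨ +-identityʳ _ ⟩
  edgeDinv c d                                                       ∎
  where
  open ≡-Reasoning
  beyond-next : dinv₂ (points upper c) (gather lower cs) ≡ 0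
  beyond-next = dinv₂-vanishes _ _
    (All.map (λ {p} p-index →
                All.map (λ {q} d<q → dinvPair-far p q (subst (λ i → suc i < fst q) (sym p-index) (≤-<-trans c<d d<q)))
                        (later-points lower d cs v))
             (points-index upper c))

dinv-local : ∀ cs → Valid cs → dinv₂ (gather upper cs) (gather lower cs) ≡ localDinv cs
dinv-local [] _ = refl
dinv-local (c ∷ cs) v = begin
  dinv₂ (U ++ Us) (L ++ Ls)                                 ≡⟨ dinv₂-++ˡ U Us (L ++ Ls) ⟩
  dinv₂ U (L ++ Ls) + dinv₂ Us (L ++ Ls)                    ≡⟨ cong₂ _+_ (dinv₂-++ʳ U L Ls) (dinv₂-++ʳ Us L Ls) ⟩
  (selfDinv c + dinv₂ U Ls) + (dinv₂ Us L + dinv₂ Us Ls)    ≡⟨ cong₂ (λ x y → (selfDinv c + x) + (y + dinv₂ Us Ls))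
                                                                     (dinv-column-to-later c cs v) (dinv-later-to-column c cs v) ⟩
  (selfDinv c + edgeToNext c cs) + dinv₂ Us Ls              ≡⟨ cong (selfDinv c + edgeToNext c cs +_) (dinv-local cs (Linked.tail v)) ⟩
  localDinv (c ∷ cs)                                        ∎
  where
  open ≡-Reasoning
  U = points upper c
  L = points lower c
  Us = gather upper cs
  Ls = gather lower cs

edgeDinv-unjoined : ∀ c d → Step c d → ¬ Joined c d → edgeDinv c d ≡ 0
edgeDinv-unjoined c d (c<d , _) ¬joined =
  dinv₂-vanishes _ _ (All.tabulate λ {p} p∈c → All.tabulate λ {q} q∈d → vanish p∈c q∈d)
  where
  vanish : ∀ {p q} → p ∈ points upper c → q ∈ points lower d → dinvPair p q ≡ 0
  vanish {p} {q} p∈c q∈d = by-distance (m≤n⇒m<n∨m≡n c<d)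
    where
    p-index = All.lookup (points-index upper c) p∈c
    q-index = All.lookup (points-index lower d) q∈d
    by-distance : suc (index c) < index d ⊎ Adjacent c d → dinvPair p q ≡ 0
    by-distance (inj₁ far) = dinvPair-far p q (subst₂ (λ i j → suc i < j) (sym p-index) (sym q-index) far)
    by-distance (inj₂ adj) =
      trans (dinvPair-adjacent p q (trans (cong suc p-index) (trans adj (sym q-index))))
            (χ-≥ (≤-trans (All.lookup (points-high lower d) q∈d)
                   (≤-trans (unjoined-high≤low c d ¬joined adj) (All.lookup (points-low upper c) p∈c))))

localDinv-concat : ∀ bs → Blocking bs → Valid (concat bs) → localDinv (concat bs) ≡ sum (map localDinv bs)
localDinv-concat [] _ _ = refl
localDinv-concat ((c ∷ b) ∷ bs) (run , bl) v =
  trans (localDinv-run c b run v) (cong (localDinv (c ∷ b) +_) (localDinv-concat bs bl (Linked-++⁻ʳ (c ∷ b) v)))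
  where
  localDinv-run : ∀ c b → RunThen c b bs → Valid (c ∷ b ++ concat bs) →
                  localDinv (c ∷ b ++ concat bs) ≡ localDinv (c ∷ b) + localDinv (concat bs)
  localDinv-run c [] ¬joined v =
    cong (_+ localDinv (concat bs)) (trans (cong (selfDinv c +_) (edge-vanishes bs ¬joined v)) (sym (+-identityʳ _)))
    where
    edge-vanishes : ∀ bs → NotJoinedTo c bs → Valid (c ∷ concat bs) → edgeToNext c (concat bs) ≡ 0
    edge-vanishes [] _ _ = refl
    edge-vanishes ((d ∷ b) ∷ bs) ¬joined v = edgeDinv-unjoined c d (Linked.head v) ¬joined
  localDinv-run c (d ∷ b) (_ , run) v =
    trans (cong (selfDinv c + edgeDinv c d +_) (localDinv-run d b run (Linked.tail v)))
          (sym (+-assoc (selfDinv c + edgeDinv c d) (localDinv (d ∷ b)) _))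

-- Signs and profiles of blocks

data Sign : Set where
  positive negative neutral : Sign

-- Entry and exit sign of a column; along joined columns each exit sign is the next entry sign.
data Signed : Column → Sign → Sign → Set where
  upper-only : ∀ {p} → Signed (only upper p) positive negative
  lower-only : ∀ {q} → Signed (only lower q) negative positive
  both-desc  : ∀ {p q e} → snd q < snd p → Signed (both p q e) positive positive
  both-asc   : ∀ {p q e} → snd p < snd q → Signed (both p q e) negative negative
  both-flat  : ∀ {p q e} → snd p ≡ snd q → Signed (both p q e) neutral neutral

signed : ∀ c → Σ Sign λ s → Σ Sign (Signed c s)
signed (only upper p) = positive , negative , upper-only
signed (only lower q) = negative , positive , lower-only
signed (both p q e) with <-cmp (snd p) (snd q)
... | tri< p<q _ _ = negative , negative , both-asc p<q
... | tri≈ _ p≡q _ = neutral , neutral , both-flat p≡q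
... | tri> _ _ q<p = positive , positive , both-desc q<p

-- The values for flat columns are irrelevant: those are never joined (unjoined-after-flat).
gain gain′ : ∀ {c s s′} → Signed c s s′ → ℕ
gain upper-only = 1
gain lower-only = 0
gain (both-desc _) = 1
gain (both-asc _) = 1
gain (both-flat _) = 1
gain′ upper-only = 0
gain′ lower-only = 1
gain′ (both-desc _) = 1
gain′ (both-asc _) = 1
gain′ (both-flat _) = 1

JoinedGains : ∀ {c s s′} → Signed c s s′ → Column → Set
JoinedGains {c} {s′ = s′} σ d =
  Σ Sign (Signed d s′) ×
  selfDinv c + edgeDinv c d ≡ gain σ ×
  selfDinv (swapColumn c) + edgeDinv (swapColumn c) (swapColumn d) ≡ gain′ σ

joined-after-upper : ∀ p d → Step (only upper p) d → Joined (only upper p) d → JoinedGains (upper-only {p}) d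
joined-after-upper p (only upper p′) (_ , dom) (adj , p<p′) = ⊥-elim (<⇒≱ p<p′ (dominated (dom adj upper)))
joined-after-upper p (only lower q′) _ (adj , p<q′) =
  (positive , lower-only) , trans (dinv₂-adjacent p q′ adj) (χ-< p<q′) , refl
joined-after-upper p (both p′ q′ e′) (_ , dom) (adj , p<high) =
  (negative , both-asc (≤-<-trans p′≤p p<q′)) , trans (dinv₂-adjacent p q′ (trans adj e′)) (χ-< p<q′) , refl
  where
  p′≤p = dominated (dom adj upper)
  p<q′ = <-⊔-cancelˡ p<high p′≤p

joined-after-lower : ∀ q d → Step (only lower q) d → Joined (only lower q) d → JoinedGains (lower-only {q}) d
joined-after-lower q (only upper p′) _ (adj , q<p′) =
  (negative , upper-only) , refl , trans (dinv₂-adjacent q p′ adj) (χ-< q<p′)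
joined-after-lower q (only lower q′) (_ , dom) (adj , q<q′) = ⊥-elim (<⇒≱ q<q′ (dominated (dom adj lower)))
joined-after-lower q (both p′ q′ e′) (_ , dom) (adj , q<high) =
  (positive , both-desc (≤-<-trans q′≤q q<p′)) , refl , trans (dinv₂-adjacent q p′ adj) (χ-< q<p′)
  where
  q′≤q = dominated (dom adj lower)
  q<p′ = <-⊔-cancelʳ q<high q′≤q

joined-after-desc : ∀ p q e d (q<p : snd q < snd p) →
                    Step (both p q e) d → Joined (both p q e) d → JoinedGains (both-desc {p} {q} {e} q<p) d
joined-after-desc p q e d q<p (_ , dom) (adj , low<high) = go d adj (dom adj) (subst (_< high d) low≡q low<high)
  where
  low≡q = m≥n⇒m⊓n≡n (<⇒≤ q<p)
  self≡1 = trans (dinv₂-column p q e) (χ-< q<p)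
  self′≡0 = trans (dinv₂-column q p (sym e)) (χ-≥ (<⇒≤ q<p))
  go : ∀ d → Adjacent (both p q e) d → (∀ s → Dominates (points s (both p q e)) (points s d)) → snd q < high d →
       JoinedGains (both-desc {p} {q} {e} q<p) d
  go (only upper p′) adj _ q<p′ =
    (negative , upper-only) , cong (_+ 0) self≡1 ,
    cong₂ _+_ self′≡0 (trans (dinv₂-adjacent q p′ (trans (cong suc (sym e)) adj)) (χ-< q<p′))
  go (only lower q′) _ dom q<q′ = ⊥-elim (<⇒≱ q<q′ (dominated (dom lower)))
  go (both p′ q′ e′) adj dom q<high =
    (positive , both-desc (≤-<-trans q′≤q q<p′)) ,
    cong₂ _+_ self≡1 (trans (dinv₂-adjacent p q′ (trans adj e′)) (χ-≥ (≤-trans q′≤q (<⇒≤ q<p)))) ,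
    cong₂ _+_ self′≡0 (trans (dinv₂-adjacent q p′ (trans (cong suc (sym e)) adj)) (χ-< q<p′))
    where
    q′≤q = dominated (dom lower)
    q<p′ = <-⊔-cancelʳ q<high q′≤q

joined-after-asc : ∀ p q e d (p<q : snd p < snd q) →
                   Step (both p q e) d → Joined (both p q e) d → JoinedGains (both-asc {p} {q} {e} p<q) d
joined-after-asc p q e d p<q (_ , dom) (adj , low<high) = go d adj (dom adj) (subst (_< high d) low≡p low<high)
  where
  low≡p = m≤n⇒m⊓n≡m (<⇒≤ p<q)
  self≡0 = trans (dinv₂-column p q e) (χ-≥ (<⇒≤ p<q))
  self′≡1 = trans (dinv₂-column q p (sym e)) (χ-< p<q)
  go : ∀ d → Adjacent (both p q e) d → (∀ s → Dominates (points s (both p q e)) (points s d)) → snd p < high d →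
       JoinedGains (both-asc {p} {q} {e} p<q) d
  go (only upper p′) _ dom p<p′ = ⊥-elim (<⇒≱ p<p′ (dominated (dom upper)))
  go (only lower q′) adj _ p<q′ =
    (positive , lower-only) , cong₂ _+_ self≡0 (trans (dinv₂-adjacent p q′ adj) (χ-< p<q′)) , cong (_+ 0) self′≡1
  go (both p′ q′ e′) adj dom p<high =
    (negative , both-asc (≤-<-trans p′≤p p<q′)) ,
    cong₂ _+_ self≡0 (trans (dinv₂-adjacent p q′ (trans adj e′)) (χ-< p<q′)) ,
    cong₂ _+_ self′≡1
      (trans (dinv₂-adjacent q p′ (trans (cong suc (sym e)) adj)) (χ-≥ (≤-trans p′≤p (<⇒≤ p<q))))
    where
    p′≤p = dominated (dom upper)
    p<q′ = <-⊔-cancelˡ p<high p′≤p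

unjoined-after-flat : ∀ p q e d → snd p ≡ snd q → Step (both p q e) d → ¬ Joined (both p q e) d
unjoined-after-flat p q e d p≡q (_ , dom) (adj , low<high) =
  <⇒≱ (subst (_< high d) (m≤n⇒m⊓n≡m (≤-reflexive p≡q)) low<high) (high≤p d (dom adj))
  where
  high≤p : ∀ d → (∀ s → Dominates (points s (both p q e)) (points s d)) → high d ≤ snd p
  high≤p (only upper p′) dom = dominated (dom upper)
  high≤p (only lower q′) dom = ≤-trans (dominated (dom lower)) (≤-reflexive (sym p≡q))
  high≤p (both p′ q′ e′) dom =
    ⊔-lub (dominated (dom upper)) (≤-trans (dominated (dom lower)) (≤-reflexive (sym p≡q)))

joined-next : ∀ {c d s s′} (σ : Signed c s s′) → Step c d → Joined c d → JoinedGains σ d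
joined-next {d = d} (upper-only {p}) = joined-after-upper p d
joined-next {d = d} (lower-only {q}) = joined-after-lower q d
joined-next {d = d} (both-desc {p} {q} {e} q<p) = joined-after-desc p q e d q<p
joined-next {d = d} (both-asc {p} {q} {e} p<q) = joined-after-asc p q e d p<q
joined-next {d = d} (both-flat {p} {q} {e} p≡q) step joined = ⊥-elim (unjoined-after-flat p q e d p≡q step joined)

-- Of a run with entry sign s and exit sign e: its local dinv D before and D′ after swapping, and
-- its numbers t and b of upper and lower points.
Profile : Sign → Sign → ℕ → ℕ → ℕ → ℕ → Set
Profile positive negative D D′ t b = D ≡ D′ × t ≡ suc b
Profile negative positive D D′ t b = D ≡ D′ × suc t ≡ b
Profile positive positive D D′ t b = D ≡ suc D′ × t ≡ b
Profile negative negative D D′ t b = suc D ≡ D′ × t ≡ b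
Profile neutral neutral D D′ t b = D ≡ D′ × t ≡ b
Profile _ _ _ _ _ _ = ⊥

Profile-cong : ∀ {s e D₁ D₂ D₁′ D₂′ t₁ t₂ b₁ b₂} → D₁ ≡ D₂ → D₁′ ≡ D₂′ → t₁ ≡ t₂ → b₁ ≡ b₂ →
               Profile s e D₁ D₁′ t₁ b₁ → Profile s e D₂ D₂′ t₂ b₂
Profile-cong refl refl refl refl profile = profile

Profile-suc : ∀ s e {D D′ t b} → Profile s e D D′ t b → Profile s e (suc D) (suc D′) (suc t) (suc b)
Profile-suc positive negative (x , y) = cong suc x , cong suc y
Profile-suc negative positive (x , y) = cong suc x , cong suc y
Profile-suc positive positive (x , y) = cong suc x , cong suc y
Profile-suc negative negative (x , y) = cong suc x , cong suc y
Profile-suc neutral neutral (x , y) = cong suc x , cong suc y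
Profile-suc positive neutral ()
Profile-suc negative neutral ()
Profile-suc neutral positive ()
Profile-suc neutral negative ()

profile-step : ∀ {c s s′ e D D′ t b} (σ : Signed c s s′) → Profile s′ e D D′ t b →
               Profile s e (gain σ + D) (gain′ σ + D′) (length (points upper c) + t) (length (points lower c) + b)
profile-step {e = positive} upper-only (D≡D′ , suc-t≡b) = cong suc D≡D′ , suc-t≡b
profile-step {e = negative} upper-only (suc-D≡D′ , t≡b) = suc-D≡D′ , cong suc t≡b
profile-step {e = positive} lower-only (D≡suc-D′ , t≡b) = D≡suc-D′ , cong suc t≡b
profile-step {e = negative} lower-only (D≡D′ , t≡suc-b) = cong suc D≡D′ , t≡suc-b
profile-step {e = e} (both-desc _) = Profile-suc positive e
profile-step {e = e} (both-asc _) = Profile-suc negative e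
profile-step {e = e} (both-flat _) = Profile-suc neutral e

Profile-imbalanced : ∀ s e {D D′ t b} → Profile s e D D′ t b → t ≢ b → D ≡ D′
Profile-imbalanced positive negative (D≡D′ , _) _ = D≡D′
Profile-imbalanced negative positive (D≡D′ , _) _ = D≡D′
Profile-imbalanced positive positive (_ , t≡b) t≢b = ⊥-elim (t≢b t≡b)
Profile-imbalanced negative negative (_ , t≡b) t≢b = ⊥-elim (t≢b t≡b)
Profile-imbalanced neutral neutral (D≡D′ , _) _ = D≡D′
Profile-imbalanced positive neutral ()
Profile-imbalanced negative neutral ()
Profile-imbalanced neutral positive ()
Profile-imbalanced neutral negative ()

BlockProfile : Sign → Sign → List Column → Set
BlockProfile s e b =
  Profile s e (localDinv b) (localDinv (map swapColumn b)) (length (gather upper b)) (length (gather lower b))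

localDinv-both : ∀ p q e → localDinv (both p q e ∷ []) ≡ χ (snd q <ᵇ snd p)
localDinv-both p q e = trans (trans (+-identityʳ _) (+-identityʳ _)) (dinv₂-column p q e)

profile-single : ∀ {c s s′} → Signed c s s′ → BlockProfile s s′ (c ∷ [])
profile-single upper-only = refl , refl
profile-single lower-only = refl , refl
profile-single (both-desc {p} {q} {e} q<p) =
  Profile-cong {positive} {positive} (sym (trans (localDinv-both p q e) (χ-< q<p)))
                                     (sym (trans (localDinv-both q p (sym e)) (χ-≥ (<⇒≤ q<p))))
                                     refl refl (refl , refl)
profile-single (both-asc {p} {q} {e} p<q) =
  Profile-cong {negative} {negative} (sym (trans (localDinv-both p q e) (χ-≥ (<⇒≤ p<q))))
                                     (sym (trans (localDinv-both q p (sym e)) (χ-< p<q)))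
                                     refl refl (refl , refl)
profile-single (both-flat {p} {q} {e} p≡q) =
  Profile-cong {neutral} {neutral} (sym (trans (localDinv-both p q e) (χ-≥ (≤-reflexive p≡q))))
                                   (sym (trans (localDinv-both q p (sym e)) (χ-≥ (≤-reflexive (sym p≡q)))))
                                   refl refl (refl , refl)

block-profile : ∀ c b {s s′} → Signed c s s′ → Valid (c ∷ b) → Linked Joined (c ∷ b) →
                Σ Sign (λ e → BlockProfile s e (c ∷ b))
block-profile c [] σ _ _ = _ , profile-single σ
block-profile c (d ∷ b) σ (step ∷ v) (joined ∷ js) =
  let ((_ , τ) , gain≡ , gain′≡) = joined-next σ step joined
      (e , profile) = block-profile d b τ v js
  in e , Profile-cong (cong (_+ localDinv (d ∷ b)) (sym gain≡))
                      (cong (_+ localDinv (map swapColumn (d ∷ b))) (sym gain′≡))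
                      (sym (length-++ (points upper c)))
                      (sym (length-++ (points lower c)))
                      (profile-step σ profile)

swapBlock-localDinv : ∀ b → Valid b → Linked Joined b → localDinv (swapBlock b) ≡ localDinv b
swapBlock-localDinv [] _ _ = refl
swapBlock-localDinv (c ∷ b) v js with imbalanced (c ∷ b) in imb
... | false = cong localDinv (map-id (c ∷ b))
... | true =
  let (s , _ , σ) = signed c
      (e , profile) = block-profile c b σ v js
  in sym (Profile-imbalanced s e profile (imbalanced⇒length≢ (c ∷ b) imb))

map-swapBlock-localDinv : ∀ bs → All (λ b → Valid b × Linked Joined b) bs →
                          map localDinv (map swapBlock bs) ≡ map localDinv bs
map-swapBlock-localDinv [] [] = refl
map-swapBlock-localDinv (b ∷ bs) ((v , js) ∷ rest) =
  cong₂ _∷_ (swapBlock-localDinv b v js) (map-swapBlock-localDinv bs rest)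

dinv-swapBlocks : ∀ cs → Valid cs →
                  dinv₂ (gather upper (swapBlocks cs)) (gather lower (swapBlocks cs)) ≡
                  dinv₂ (gather upper cs) (gather lower cs)
dinv-swapBlocks cs v = begin
  dinv₂ (gather upper (swapBlocks cs)) (gather lower (swapBlocks cs))
    ≡⟨ dinv-local (swapBlocks cs) (valid-swapBlocks cs v) ⟩
  localDinv (concat (map swapBlock bs))
    ≡⟨ localDinv-concat (map swapBlock bs) (Blocking-swap bs bl) (valid-swapBlocks cs v) ⟩
  sum (map localDinv (map swapBlock bs))
    ≡⟨ cong sum (map-swapBlock-localDinv bs (blocks-valid bs bl v′)) ⟩
  sum (map localDinv bs)
    ≡⟨ localDinv-concat bs bl v′ ⟨
  localDinv (concat bs)
    ≡⟨ cong localDinv (concat-blocks cs) ⟩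
  localDinv cs
    ≡⟨ dinv-local cs v ⟨
  dinv₂ (gather upper cs) (gather lower cs) ∎
  where
  open ≡-Reasoning
  bs = blocks cs
  bl = blocks-Blocking cs
  v′ = subst Valid (sym (concat-blocks cs)) v

length-gather-swapBlock : ∀ s b → length (gather s (swapBlock b)) ≡ length (gather (opposite s) b)
length-gather-swapBlock s b with imbalanced b in imb
... | true = cong length (gather-swap s b)
... | false = trans (cong (length ∘ gather s) (map-id b)) (balanced s)
  where
  balanced : ∀ s → length (gather s b) ≡ length (gather (opposite s) b)
  balanced upper = balanced⇒length≡ b imb
  balanced lower = sym (balanced⇒length≡ b imb)

length-gather-concat : ∀ s bs → length (gather s (concat bs)) ≡ sum (map (length ∘ gather s) bs)
length-gather-concat s [] = refl
length-gather-concat s (b ∷ bs) =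
  trans (cong length (gather-++ s b (concat bs)))
        (trans (length-++ (gather s b)) (cong (length (gather s b) +_) (length-gather-concat s bs)))

length-gather-swapBlocks : ∀ s cs → length (gather s (swapBlocks cs)) ≡ length (gather (opposite s) cs)
length-gather-swapBlocks s cs = begin
  length (gather s (concat (map swapBlock (blocks cs))))    ≡⟨ length-gather-concat s (map swapBlock (blocks cs)) ⟩
  sum (map (length ∘ gather s) (map swapBlock (blocks cs))) ≡⟨ cong sum (map-∘ (blocks cs)) ⟨
  sum (map (length ∘ gather s ∘ swapBlock) (blocks cs))     ≡⟨ cong sum (map-cong (length-gather-swapBlock s) (blocks cs)) ⟩
  sum (map (length ∘ gather (opposite s)) (blocks cs))      ≡⟨ length-gather-concat (opposite s) (blocks cs) ⟨
  length (gather (opposite s) (concat (blocks cs)))         ≡⟨ cong (length ∘ gather (opposite s)) (concat-blocks cs) ⟩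
  length (gather (opposite s) cs)                           ∎
  where open ≡-Reasoning

gathers : List Column → List Pt
gathers cs = gather upper cs ++ gather lower cs

gathers-swapBlock : ∀ b → gathers (swapBlock b) ↭ gathers b
gathers-swapBlock b with imbalanced b
... | true = ↭-trans (↭-reflexive (cong₂ _++_ (gather-swap upper b) (gather-swap lower b))) (++-comm (gather lower b) _)
... | false = ↭-reflexive (cong gathers (map-id b))

gathers-concat : ∀ b bs → gathers (b ++ bs) ↭ gathers b ++ gathers bs
gathers-concat b bs = ↭-trans (↭-reflexive (cong₂ _++_ (gather-++ upper b bs) (gather-++ lower b bs)))
                             (++-interchange (gather upper b) (gather upper bs) (gather lower b) (gather lower bs))

gathers-swapBlocks : ∀ cs → gathers (swapBlocks cs) ↭ gathers cs
gathers-swapBlocks cs = ↭-trans (go (blocks cs)) (↭-reflexive (cong gathers (concat-blocks cs)))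
  where
  go : ∀ bs → gathers (concat (map swapBlock bs)) ↭ gathers (concat bs)
  go [] = ↭-refl
  go (b ∷ bs) = ↭-trans (gathers-concat (swapBlock b) _)
                  (↭-trans (++⁺-↭ (gathers-swapBlock b) (go bs)) (↭-sym (gathers-concat b (concat bs))))

-- The bijection

toList-cast-fromList : ∀ {A : Set} {k} (l : List A) (len : length l ≡ k) → toList (cast len (fromList l)) ≡ l
toList-cast-fromList l len = trans (toList-cast len (fromList l)) (toList∘fromList l)

chain : ∀ {k} (l : List Pt) → length l ≡ k → AllPairs _≺_ l → C k
chain l len ch = cast len (fromList l) , subst (T ∘ chainᵇ) (sym (toList-cast-fromList l len)) (AllPairs⇒chainᵇ l ch)

elems-injective : ∀ {k} (a b : C k) → elems a ≡ elems b → a ≡ b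
elems-injective (u , pu) (v , pv) e with trans (sym (cast-is-id refl u)) (toList-injective refl u v e)
... | refl = cong (u ,_) (T-irrelevant pu pv)

length-elems : ∀ {k} (a : C k) → length (elems a) ≡ k
length-elems (v , _) = length-toList v

module _ {n m : ℕ} where

  columns : C n × C m → List Column
  columns (c , d) = merge (elems c) (elems d)

  columns-valid : ∀ L → Valid (columns L)
  columns-valid (c , d) = merge-valid (elems c) (elems d) (chainᵇ⇒AllPairs _ (proj₂ c)) (chainᵇ⇒AllPairs _ (proj₂ d))

  gather-columns-upper : ∀ L → gather upper (columns L) ≡ elems (proj₁ L)
  gather-columns-upper (c , d) = gather-merge-upper (elems c) (elems d)

  gather-columns-lower : ∀ L → gather lower (columns L) ≡ elems (proj₂ L)
  gather-columns-lower (c , d) = gather-merge-lower (elems c) (elems d)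

  swapped : C n × C m → List Column
  swapped L = swapBlocks (columns L)

  swapped-valid : ∀ L → Valid (swapped L)
  swapped-valid L = valid-swapBlocks (columns L) (columns-valid L)

  length-swapped-upper : ∀ L → length (gather upper (swapped L)) ≡ m
  length-swapped-upper L = trans (length-gather-swapBlocks upper (columns L))
                                 (trans (cong length (gather-columns-lower L)) (length-elems (proj₂ L)))

  length-swapped-lower : ∀ L → length (gather lower (swapped L)) ≡ n
  length-swapped-lower L = trans (length-gather-swapBlocks lower (columns L))
                                 (trans (cong length (gather-columns-upper L)) (length-elems (proj₁ L)))

  sw : C n × C m → C m × C n
  sw L = chain (gather upper (swapped L)) (length-swapped-upper L) (gather-chain upper (swapped L) (swapped-valid L)) ,
         chain (gather lower (swapped L)) (length-swapped-lower L) (gather-chain lower (swapped L) (swapped-valid L))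

  elems-sw-upper : ∀ L → elems (proj₁ (sw L)) ≡ gather upper (swapped L)
  elems-sw-upper L = toList-cast-fromList (gather upper (swapped L)) (length-swapped-upper L)

  elems-sw-lower : ∀ L → elems (proj₂ (sw L)) ≡ gather lower (swapped L)
  elems-sw-lower L = toList-cast-fromList (gather lower (swapped L)) (length-swapped-lower L)

columns-sw : ∀ {n m} (L : C n × C m) → columns (sw L) ≡ swapped L
columns-sw L = trans (cong₂ merge (elems-sw-upper L) (elems-sw-lower L)) (merge-gather (swapped L) (swapped-valid L))

sw-involutive : ∀ {n m} (L : C n × C m) → sw (sw L) ≡ L
sw-involutive L@(c , d) =
  cong₂ _,_ (elems-injective _ c (trans (elems-sw-upper (sw L)) (trans (twice upper) (gather-columns-upper L))))
            (elems-injective _ d (trans (elems-sw-lower (sw L)) (trans (twice lower) (gather-columns-lower L))))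
  where
  twice : ∀ s → gather s (swapBlocks (columns (sw L))) ≡ gather s (columns L)
  twice s = cong (gather s) (trans (cong swapBlocks (columns-sw L)) (swapBlocks-involutive (columns L)))

yC-sw : ∀ {n m} (L : C n × C m) → yC L ↭ yC (sw L)
yC-sw L = begin
  yC L                                  ≡⟨ cong₂ _++_ (gather-columns-upper L) (gather-columns-lower L) ⟨
  gathers (columns L)                   ↭⟨ gathers-swapBlocks (columns L) ⟨
  gathers (swapBlocks (columns L))      ≡⟨ cong₂ _++_ (elems-sw-upper L) (elems-sw-lower L) ⟨
  yC (sw L)                             ∎
  where open PermutationReasoning

dinvC-sw : ∀ {n m} (L : C n × C m) → dinvC L ≡ dinvC (sw L)
dinvC-sw L = begin
  dinvC L                                                          ≡⟨ cong₂ dinv₂ (gather-columns-upper L) (gather-columns-lower L) ⟨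
  dinv₂ (gather upper (columns L)) (gather lower (columns L))      ≡⟨ dinv-swapBlocks (columns L) (columns-valid L) ⟨
  dinv₂ (gather upper (swapBlocks (columns L))) (gather lower (swapBlocks (columns L)))
                                                                   ≡⟨ cong₂ dinv₂ (elems-sw-upper L) (elems-sw-lower L) ⟨
  dinvC (sw L)                                                     ∎
  where open ≡-Reasoning

lemma4p4 : (n m : ℕ) →
    Σ ((C n × C m) ⤖ (C m × C n)) (λ SW →
      (L : C n × C m) →
        (yC L ↭ yC (Bijection.to SW L)) × (dinvC L ≡ dinvC (Bijection.to SW L)))
lemma4p4 n m = ↔⇒⤖ (mk↔ₛ′ sw sw sw-involutive sw-involutive) , λ L → yC-sw L , dinvC-sw L
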